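{- Let $m,n\geq 1$ and $t\geq 2$ be integers, and let $D$ be a defining set for the full $(m,n,t)$-balanced rectangle $F_{m,n,t}$. Then for each pair $\{a,b\}\subset N(t)$ with $a\neq b$, the number $|S_{a,b}(D)|$ of cells of $D$ containing neither $a$ nor $b$ satisfies $|S_{a,b}(D)|\leq m+n-1$.
   Context: $N(a)=\{1,2,\dots,a\}$. An $(m,n,t)$-balanced rectangle is an $m\times n$ array whose cells are multisets of size exactly $t$ with elements from $N(t)$, such that each element of $N(t)$ occurs exactly $n$ times (counted with multiplicity) in each row and exactly $m$ times in each column; a partial $(m,n,t)$-balanced rectangle is an $m\times n$ array of multisets of size at most $t$ over $N(t)$ in which each element occurs at most $n$ times in each row and at most $m$ times in each column. $F_{m,n,t}$ is the $(m,n,t)$-balanced rectangle with the set $N(t)$ in every cell. Here $D$ is a partial $(m,n,t)$-balanced rectangle each of whose cells is a subset of $N(t)$ (so $D$ is contained cellwise in $F_{m,n,t}$). A completion of $D$ is an $(m,n,t)$-balanced rectangle $L$ such that each cell of $D$ is a sub-multiset of the corresponding cell of $L$. $D$ is a defining set for $F_{m,n,t}$ if $F_{m,n,t}$ is the unique completion of $D$. For distinct $a,b\in N(t)$, $S_{a,b}(D)$ is the set of cells of $D$ which contain neither $a$ nor $b$. -}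

module Defs where

open import Data.Nat using (ℕ; zero; suc; _+_; _≤_)
open import Data.Fin using (Fin; zero; suc)
open import Data.Bool using (Bool; true; false)
open import Data.Product using (_×_)
open import Relation.Binary.PropositionalEquality using (_≡_)

sumFin : ∀ {n} → (Fin n → ℕ) → ℕ
sumFin {zero}  f = 0
sumFin {suc n} f = f zero + sumFin (λ i → f (suc i))

-- A multiset over N(t) = Fin t is given by its multiplicity function.
Multiset : ℕ → Set
Multiset t = Fin t → ℕ

∣_∣ₘ : ∀ {t} → Multiset t → ℕ
∣ c ∣ₘ = sumFin c

Array : ℕ → ℕ → ℕ → Set
Array m n t = Fin m → Fin n → Multiset t

IsBalanced : ∀ {m n t} → Array m n t → Set
IsBalanced {m} {n} {t} L =
  (∀ i j → ∣ L i j ∣ₘ ≡ t)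
  × (∀ i k → sumFin (λ j → L i j k) ≡ n)
  × (∀ j k → sumFin (λ i → L i j k) ≡ m)

IsPartial : ∀ {m n t} → Array m n t → Set
IsPartial {m} {n} {t} L =
  (∀ i j → ∣ L i j ∣ₘ ≤ t)
  × (∀ i k → sumFin (λ j → L i j k) ≤ n)
  × (∀ j k → sumFin (λ i → L i j k) ≤ m)

SubsetArray : ℕ → ℕ → ℕ → Set
SubsetArray m n t = Fin m → Fin n → Fin t → Bool

χ : Bool → ℕ
χ true  = 1
χ false = 0

asArray : ∀ {m n t} → SubsetArray m n t → Array m n t
asArray D i j k = χ (D i j k)

F : ∀ m n t → Array m n t
F m n t i j k = 1

_⊑_ : ∀ {m n t} → Array m n t → Array m n t → Set
D ⊑ L = ∀ i j k → D i j k ≤ L i j k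

IsCompletion : ∀ {m n t} → Array m n t → Array m n t → Set
IsCompletion D L = IsBalanced L × (D ⊑ L)

IsDefiningSetForF : ∀ {m n t} → Array m n t → Set
IsDefiningSetForF {m} {n} {t} D =
  IsCompletion D (F m n t)
  × (∀ L → IsCompletion D L → ∀ i j k → L i j k ≡ F m n t i j k)

χneither : Bool → Bool → ℕ
χneither false false = 1
χneither _     _     = 0

sizeS : ∀ {m n t} → SubsetArray m n t → Fin t → Fin t → ℕ
sizeS D a b = sumFin (λ i → sumFin (λ j → χneither (D i j a) (D i j b)))

module Submission where

open import Defs
open import Data.Nat using (ℕ; zero; suc; _+_; _*_; _∸_; _≤_; _<_; z≤n; s≤s; _≤?_)
open import Data.Nat.Properties
  using (+-0-commutativeMonoid; +-comm; +-suc; +-identityʳ; *-identityʳ; *-zeroʳ; +-cancelʳ-≡;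
         suc-injective; ≤-refl; ≤-trans; ≤-antisym; ≤-pred; <-≤-trans; ≰⇒>; n≤1+n; m≤m+n;
         m≤n+m; m<m+n; m<n+m; +-mono-≤; +-monoˡ-≤; +-monoʳ-≤; +-monoʳ-<; *-cancelˡ-<;
         module ≤-Reasoning)
open import Data.Nat.Induction using (<-rec)
open import Data.Nat.Tactic.RingSolver using (solve)
open import Data.List.Base using ([]; _∷_)
open import Data.Fin using (Fin; zero; suc; punchIn)
open import Data.Fin.Properties using (_≟_; punchInᵢ≢i; any?) renaming (suc-injective to Fin-suc-injective)
open import Data.Fin.Permutation as Perm using (Permutation; _⟨$⟩ʳ_; _⟨$⟩ˡ_)
import Data.Bool as Bool
open import Data.Bool using (Bool; true; false; _∧_; _∨_; not; if_then_else_)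
open import Data.Bool.Properties using (∧-comm; ∧-assoc; ∧-zeroʳ; ∧-identityʳ; ¬-not)
open import Data.Product using (_×_; _,_; proj₁; proj₂; Σ; ∃)
open import Data.Empty using (⊥-elim)
open import Relation.Nullary using (Dec; yes; no; does)
open import Relation.Binary.PropositionalEquality
import Algebra.Properties.CommutativeMonoid.Sum as CommutativeMonoidSum

-- Let S be the set of cells of D containing neither a nor b,
-- viewed as an m × n 0/1 matrix, i.e. a bipartite graph on the m + n rows
-- and columns.  If S had at least m + n ones, this graph would contain an
-- even cycle, that is a trade: two matchings P ≠ N inside S with the same
-- row and column sums.  Trading a copy of b for a copy of a in the cells of
-- P, and a copy of a for b in the cells of N, turns F into another balanced
-- rectangle, which still contains D because the cells of S avoid a and b;
-- so D would not be a defining set.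

module Σℕ = CommutativeMonoidSum +-0-commutativeMonoid

-- sumFin is the library's finite sum over the monoid (ℕ, +, 0), so its
-- algebraic laws can be imported rather than re-proved.
sumFin≡sum : ∀ {n} (f : Fin n → ℕ) → sumFin f ≡ Σℕ.sum f
sumFin≡sum {zero}  f = refl
sumFin≡sum {suc n} f = cong (f zero +_) (sumFin≡sum (λ i → f (suc i)))

sumFin-cong : ∀ {n} {f g : Fin n → ℕ} → (∀ i → f i ≡ g i) → sumFin f ≡ sumFin g
sumFin-cong {zero}  f≗g = refl
sumFin-cong {suc n} f≗g = cong₂ _+_ (f≗g zero) (sumFin-cong (λ i → f≗g (suc i)))

sumFin-mono : ∀ {n} {f g : Fin n → ℕ} → (∀ i → f i ≤ g i) → sumFin f ≤ sumFin g
sumFin-mono {zero}  f≤g = z≤n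
sumFin-mono {suc n} f≤g = +-mono-≤ (f≤g zero) (sumFin-mono (λ i → f≤g (suc i)))

sumFin-const : ∀ {n} c → sumFin {n} (λ _ → c) ≡ n * c
sumFin-const {zero}  c = refl
sumFin-const {suc n} c = cong (c +_) (sumFin-const {n} c)

sumFin-zero : ∀ n → sumFin {n} (λ _ → 0) ≡ 0
sumFin-zero n = trans (sumFin-const {n} 0) (*-zeroʳ n)

sumFin-+ : ∀ {n} (f g : Fin n → ℕ) → sumFin (λ i → f i + g i) ≡ sumFin f + sumFin g
sumFin-+ f g = begin
  sumFin (λ i → f i + g i)   ≡⟨ sumFin≡sum (λ i → f i + g i) ⟩
  Σℕ.sum (λ i → f i + g i)   ≡⟨ Σℕ.∑-distrib-+ f g ⟩
  Σℕ.sum f + Σℕ.sum g        ≡⟨ sym (cong₂ _+_ (sumFin≡sum f) (sumFin≡sum g)) ⟩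
  sumFin f + sumFin g        ∎
  where open ≡-Reasoning

sumFin-comm : ∀ {m n} (f : Fin m → Fin n → ℕ) →
  sumFin (λ i → sumFin (λ j → f i j)) ≡ sumFin (λ j → sumFin (λ i → f i j))
sumFin-comm f = begin
  sumFin (λ i → sumFin (f i))              ≡⟨ sumFin≡sum (λ i → sumFin (f i)) ⟩
  Σℕ.sum (λ i → sumFin (f i))              ≡⟨ Σℕ.sum-cong-≗ (λ i → sumFin≡sum (f i)) ⟩
  Σℕ.sum (λ i → Σℕ.sum (f i))              ≡⟨ Σℕ.∑-comm f ⟩
  Σℕ.sum (λ j → Σℕ.sum (λ i → f i j))      ≡⟨ Σℕ.sum-cong-≗ (λ j → sym (sumFin≡sum (λ i → f i j))) ⟩
  Σℕ.sum (λ j → sumFin (λ i → f i j))      ≡⟨ sym (sumFin≡sum (λ j → sumFin (λ i → f i j))) ⟩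
  sumFin (λ j → sumFin (λ i → f i j))      ∎
  where open ≡-Reasoning

sumFin-permute : ∀ {n} (f : Fin n → ℕ) (π : Permutation n n) →
  sumFin (λ i → f (π ⟨$⟩ʳ i)) ≡ sumFin f
sumFin-permute f π = begin
  sumFin (λ i → f (π ⟨$⟩ʳ i))  ≡⟨ sumFin≡sum (λ i → f (π ⟨$⟩ʳ i)) ⟩
  Σℕ.sum (λ i → f (π ⟨$⟩ʳ i))  ≡⟨ sym (Σℕ.sum-permute f π) ⟩
  Σℕ.sum f                     ≡⟨ sym (sumFin≡sum f) ⟩
  sumFin f                     ∎
  where open ≡-Reasoning

sumFin-remove : ∀ {n} (f : Fin (suc n) → ℕ) (i : Fin (suc n)) →
  sumFin f ≡ f i + sumFin (λ k → f (punchIn i k))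
sumFin-remove f i = begin
  sumFin f                          ≡⟨ sumFin≡sum f ⟩
  Σℕ.sum f                          ≡⟨ Σℕ.sum-remove f ⟩
  f i + Σℕ.sum (λ k → f (punchIn i k)) ≡⟨ cong (f i +_) (sym (sumFin≡sum (λ k → f (punchIn i k)))) ⟩
  f i + sumFin (λ k → f (punchIn i k)) ∎
  where open ≡-Reasoning

sumFin-pos : ∀ {n} (f : Fin n → ℕ) → 1 ≤ sumFin f → ∃ λ i → 1 ≤ f i
sumFin-pos {zero}  f ()
sumFin-pos {suc n} f pos with f zero in eq
... | suc _ = zero , subst (1 ≤_) (sym eq) (s≤s z≤n)
... | zero with sumFin-pos (λ i → f (suc i)) pos
...   | i , fi>0 = suc i , fi>0

χ≤1 : ∀ b → χ b ≤ 1
χ≤1 true  = s≤s z≤n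
χ≤1 false = z≤n

χ-∨ : ∀ x y → x ∧ y ≡ false → χ (x ∨ y) ≡ χ x + χ y
χ-∨ true  true  ()
χ-∨ true  false _ = refl
χ-∨ false y     _ = refl

χ-disjoint≤1 : ∀ x y → x ∧ y ≡ false → χ x + χ y ≤ 1
χ-disjoint≤1 x y x∧y≡false = subst (_≤ 1) (χ-∨ x y x∧y≡false) (χ≤1 (x ∨ y))

χ-split : ∀ x y z → (x ≡ true → y ∨ z ≡ true) → y ∧ z ≡ false →
  χ x ≡ χ (x ∧ y) + χ (x ∧ z)
χ-split false y     z     _     _  = refl
χ-split true  true  true  _     ()
χ-split true  true  false _     _  = refl
χ-split true  false true  _     _  = refl
χ-split true  false false cover _  with cover refl
... | ()

χ-remove : ∀ x y → (y ≡ true → x ≡ true) → χ x ≡ χ (x ∧ not y) + χ y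
χ-remove x     false _   = sym (trans (+-identityʳ _) (cong χ (∧-identityʳ x)))
χ-remove true  true  _   = refl
χ-remove false true  y⇒x with y⇒x refl
... | ()

∧-true : ∀ {x y} → x ∧ y ≡ true → x ≡ true × y ≡ true
∧-true {true} y≡true = refl , y≡true

χ-pos : ∀ {b} → 1 ≤ χ b → b ≡ true
χ-pos {true} _ = refl

excluded : ∀ {x y} → y ≡ true → (x ≡ true → y ≡ false) → x ≡ false
excluded {false} _        _  = refl
excluded {true}  refl y≡false with y≡false refl
... | ()

δ : ∀ {n} → Fin n → Fin n → Bool
δ c k = does (c ≟ k)

δ-refl : ∀ {n} (c : Fin n) → δ c c ≡ true
δ-refl c with c ≟ c
... | yes _   = refl
... | no  c≢c = ⊥-elim (c≢c refl)

δ-sound : ∀ {n} {c k : Fin n} → δ c k ≡ true → c ≡ k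
δ-sound {c = c} {k} eq with c ≟ k
... | yes c≡k = c≡k

δ-distinct : ∀ {n} {c k : Fin n} → c ≢ k → δ c k ≡ false
δ-distinct {c = c} {k} c≢k with c ≟ k
... | yes c≡k = ⊥-elim (c≢k c≡k)
... | no  _   = refl

δ-disjoint : ∀ {n} {c c′ : Fin n} → c ≢ c′ → ∀ k → δ c k ∧ δ c′ k ≡ false
δ-disjoint {c = c} {c′} c≢c′ k with c ≟ k
... | no  _    = refl
... | yes refl = δ-distinct (λ e → c≢c′ (sym e))

sumFin-sift : ∀ {n} (f : Fin n → Bool) (c : Fin n) →
  sumFin (λ k → χ (f k ∧ δ c k)) ≡ χ (f c)
sumFin-sift {suc n} f c = begin
  sumFin (λ k → χ (f k ∧ δ c k))
    ≡⟨ sumFin-remove (λ k → χ (f k ∧ δ c k)) c ⟩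
  χ (f c ∧ δ c c) + sumFin (λ k → χ (f (punchIn c k) ∧ δ c (punchIn c k)))
    ≡⟨ cong₂ (λ x y → χ (f c ∧ x) + y) (δ-refl c) (sumFin-cong off-c) ⟩
  χ (f c ∧ true) + sumFin {n} (λ _ → 0)
    ≡⟨ cong₂ _+_ (cong χ (∧-identityʳ (f c))) (sumFin-zero n) ⟩
  χ (f c) + 0
    ≡⟨ +-identityʳ _ ⟩
  χ (f c) ∎
  where
  open ≡-Reasoning
  off-c : ∀ k → χ (f (punchIn c k) ∧ δ c (punchIn c k)) ≡ 0
  off-c k rewrite δ-distinct (λ e → punchInᵢ≢i c k (sym e)) = cong χ (∧-zeroʳ (f (punchIn c k)))

sumFin-δ : ∀ {n} (c : Fin n) → sumFin (λ k → χ (δ c k)) ≡ 1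
sumFin-δ c = sumFin-sift (λ _ → true) c

oneOf : ∀ {n} (f : Fin n → Bool) → 1 ≤ sumFin (λ j → χ (f j)) → ∃ λ j → f j ≡ true
oneOf f pos with sumFin-pos (λ j → χ (f j)) pos
... | j , fj>0 = j , χ-pos fj>0

twoOf : ∀ {n} (f : Fin n → Bool) → 2 ≤ sumFin (λ j → χ (f j)) →
  Σ (Fin n) λ j₁ → Σ (Fin n) λ j₂ → j₁ ≢ j₂ × f j₁ ≡ true × f j₂ ≡ true
twoOf {suc n} f two with f zero in f₀
... | true  with oneOf (λ j → f (suc j)) (≤-pred two)
...   | j , fj = zero , suc j , (λ ()) , f₀ , fj
twoOf {suc n} f two | false with twoOf (λ j → f (suc j)) two
...   | j₁ , j₂ , j₁≢j₂ , f₁ , f₂ = suc j₁ , suc j₂ , (λ e → j₁≢j₂ (Fin-suc-injective e)) , f₁ , f₂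

Matrix : ℕ → ℕ → Set
Matrix m n = Fin m → Fin n → Bool

_ᵀ : ∀ {m n} → Matrix m n → Matrix n m
(S ᵀ) j i = S i j

rowSum : ∀ {m n} → Matrix m n → Fin m → ℕ
rowSum S i = sumFin (λ j → χ (S i j))

colSum : ∀ {m n} → Matrix m n → Fin n → ℕ
colSum S = rowSum (S ᵀ)

size : ∀ {m n} → Matrix m n → ℕ
size S = sumFin (rowSum S)

infix 4 _⊆_
_⊆_ : ∀ {m n} → Matrix m n → Matrix m n → Set
X ⊆ S = ∀ i j → X i j ≡ true → S i j ≡ true

size-ᵀ : ∀ {m n} (S : Matrix m n) → size (S ᵀ) ≡ size S
size-ᵀ S = sym (sumFin-comm (λ i j → χ (S i j)))

cell : ∀ {m n} → Fin m → Fin n → Matrix m n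
cell r c i j = δ r i ∧ δ c j

rowSum-cell : ∀ {m n} (r : Fin m) (c : Fin n) i → rowSum (cell r c) i ≡ χ (δ r i)
rowSum-cell r c i = sumFin-sift (λ _ → δ r i) c

colSum-cell : ∀ {m n} (r : Fin m) (c : Fin n) j → colSum (cell r c) j ≡ χ (δ c j)
colSum-cell r c j =
  trans (sumFin-cong (λ i → cong χ (∧-comm (δ r i) (δ c j)))) (sumFin-sift (λ _ → δ c j) r)

size-cell : ∀ {m n} (r : Fin m) (c : Fin n) → size (cell r c) ≡ 1
size-cell r c = trans (sumFin-cong (rowSum-cell r c)) (sumFin-δ r)

cell-⊆ : ∀ {m n} {S : Matrix m n} {r c} → S r c ≡ true → cell r c ⊆ S
cell-⊆ {S = S} {r} {c} Src i j rc with ∧-true {δ r i} rc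
... | r≡i , c≡j = subst₂ (λ x y → S x y ≡ true) (δ-sound r≡i) (δ-sound c≡j) Src

cell-disjoint : ∀ {m n} {r r′ : Fin m} → r ≢ r′ → ∀ (c c′ : Fin n) i j →
  cell r c i j ∧ cell r′ c′ i j ≡ false
cell-disjoint {r = r} {r′} r≢r′ c c′ i j
  with δ r i | δ r′ i | δ-disjoint r≢r′ i
... | false | _     | _  = refl
... | true  | false | _  = ∧-zeroʳ (δ c j)
... | true  | true  | ()

infixr 6 _∪_
_∪_ : ∀ {m n} → Matrix m n → Matrix m n → Matrix m n
(X ∪ Y) i j = X i j ∨ Y i j

∪-⊆ : ∀ {m n} {X Y S : Matrix m n} → X ⊆ S → Y ⊆ S → X ∪ Y ⊆ S
∪-⊆ {X = X} X⊆S Y⊆S i j xy with X i j in eq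
... | true  = X⊆S i j eq
... | false = Y⊆S i j xy

rowSum-∪ : ∀ {m n} (X Y : Matrix m n) i → (∀ j → X i j ∧ Y i j ≡ false) →
  rowSum (X ∪ Y) i ≡ rowSum X i + rowSum Y i
rowSum-∪ X Y i disjoint =
  trans (sumFin-cong (λ j → χ-∨ (X i j) (Y i j) (disjoint j)))
        (sumFin-+ (λ j → χ (X i j)) (λ j → χ (Y i j)))

colSum-∪ : ∀ {m n} (X Y : Matrix m n) j → (∀ i → X i j ∧ Y i j ≡ false) →
  colSum (X ∪ Y) j ≡ colSum X j + colSum Y j
colSum-∪ X Y = rowSum-∪ (X ᵀ) (Y ᵀ)

removeCell : ∀ {m n} → Fin m → Fin n → Matrix m n → Matrix m n
removeCell r c S i j = S i j ∧ not (cell r c i j)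

size-removeCell : ∀ {m n} (S : Matrix m n) {r c} → S r c ≡ true →
  size S ≡ size (removeCell r c S) + 1
size-removeCell S {r} {c} Src = begin
  size S
    ≡⟨ sumFin-cong (λ i → sumFin-cong (λ j → χ-remove (S i j) (cell r c i j) (cell-⊆ {S = S} {r} {c} Src i j))) ⟩
  sumFin (λ i → sumFin (λ j → χ (removeCell r c S i j) + χ (cell r c i j)))
    ≡⟨ sumFin-cong (λ i → sumFin-+ (λ j → χ (removeCell r c S i j)) (λ j → χ (cell r c i j))) ⟩
  sumFin (λ i → rowSum (removeCell r c S) i + rowSum (cell r c) i)
    ≡⟨ sumFin-+ (rowSum (removeCell r c S)) (rowSum (cell r c)) ⟩
  size (removeCell r c S) + size (cell r c)
    ≡⟨ cong (size (removeCell r c S) +_) (size-cell r c) ⟩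
  size (removeCell r c S) + 1 ∎
  where open ≡-Reasoning

record Witness {m n} (P N : Matrix m n) : Set where
  constructor witness
  field
    row    : Fin m
    col    : Fin n
    P-one  : P row col ≡ true
    N-zero : N row col ≡ false

record Trade {m n} (S : Matrix m n) : Set where
  field
    P N         : Matrix m n
    P⊆S         : P ⊆ S
    N⊆S         : N ⊆ S
    rowBalanced : ∀ i → rowSum P i ≡ rowSum N i
    colBalanced : ∀ j → colSum P j ≡ colSum N j
    rowMatching : ∀ i → rowSum P i ≤ 1
    colMatching : ∀ j → colSum P j ≤ 1
    differ      : Witness P N

trade-⊆ : ∀ {m n} {X S : Matrix m n} → X ⊆ S → Trade X → Trade S
trade-⊆ X⊆S T = record
  { P = P ; N = N
  ; P⊆S = λ i j p → X⊆S i j (P⊆S i j p) ; N⊆S = λ i j p → X⊆S i j (N⊆S i j p)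
  ; rowBalanced = rowBalanced ; colBalanced = colBalanced
  ; rowMatching = rowMatching ; colMatching = colMatching
  ; differ = differ }
  where open Trade T

trade-ᵀ : ∀ {m n} {S : Matrix m n} → Trade (S ᵀ) → Trade S
trade-ᵀ T = record
  { P = P ᵀ ; N = N ᵀ ; P⊆S = λ i j → P⊆S j i ; N⊆S = λ i j → N⊆S j i
  ; rowBalanced = colBalanced ; colBalanced = rowBalanced
  ; rowMatching = colMatching ; colMatching = rowMatching
  ; differ = witness (Witness.col differ) (Witness.row differ)
                     (Witness.P-one differ) (Witness.N-zero differ) }
  where open Trade T

permuteRows : ∀ {m n} → Permutation m m → Matrix m n → Matrix m n
permuteRows π S i = S (π ⟨$⟩ʳ i)

permuteCols : ∀ {m n} → Permutation n n → Matrix m n → Matrix m n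
permuteCols σ S = permuteRows σ (S ᵀ) ᵀ

size-permuteRows : ∀ {m n} (π : Permutation m m) (S : Matrix m n) →
  size (permuteRows π S) ≡ size S
size-permuteRows π S = sumFin-permute (rowSum S) π

size-permuteCols : ∀ {m n} (σ : Permutation n n) (S : Matrix m n) →
  size (permuteCols σ S) ≡ size S
size-permuteCols σ S = begin
  size (permuteCols σ S)             ≡⟨ sym (size-ᵀ (permuteCols σ S)) ⟩
  size (permuteRows σ (S ᵀ))         ≡⟨ size-permuteRows σ (S ᵀ) ⟩
  size (S ᵀ)                         ≡⟨ size-ᵀ S ⟩
  size S                             ∎
  where open ≡-Reasoning

rowSum-permuteCols : ∀ {m n} (σ : Permutation n n) (S : Matrix m n) i →
  rowSum (permuteCols σ S) i ≡ rowSum S i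
rowSum-permuteCols σ S i = sumFin-permute (λ j → χ (S i j)) σ

trade-permuteRows : ∀ {m n} {S : Matrix m n} (π : Permutation m m) →
  Trade (permuteRows π S) → Trade S
trade-permuteRows {m} {S = S} π T = record
  { P = permuteRows π⁻¹ P ; N = permuteRows π⁻¹ N
  ; P⊆S = λ i j p → subst (λ r → S r j ≡ true) (Perm.inverseʳ π) (P⊆S _ j p)
  ; N⊆S = λ i j p → subst (λ r → S r j ≡ true) (Perm.inverseʳ π) (N⊆S _ j p)
  ; rowBalanced = λ i → rowBalanced (π ⟨$⟩ˡ i)
  ; colBalanced = λ j → begin
      colSum (permuteRows π⁻¹ P) j  ≡⟨ sumFin-permute (λ i → χ (P i j)) π⁻¹ ⟩
      colSum P j                     ≡⟨ colBalanced j ⟩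
      colSum N j                     ≡⟨ sym (sumFin-permute (λ i → χ (N i j)) π⁻¹) ⟩
      colSum (permuteRows π⁻¹ N) j  ∎
  ; rowMatching = λ i → rowMatching (π ⟨$⟩ˡ i)
  ; colMatching = λ j →
      subst (_≤ 1) (sym (sumFin-permute (λ i → χ (P i j)) π⁻¹)) (colMatching j)
  ; differ = let open Witness differ in witness (π ⟨$⟩ʳ row) col
      (subst (λ r → P r col ≡ true)  (sym (Perm.inverseˡ π)) P-one)
      (subst (λ r → N r col ≡ false) (sym (Perm.inverseˡ π)) N-zero) }
  where
  open Trade T
  open ≡-Reasoning
  π⁻¹ : Permutation m m
  π⁻¹ = Perm.flip π

trade-permuteCols : ∀ {m n} {S : Matrix m n} (σ : Permutation n n) →
  Trade (permuteCols σ S) → Trade S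
trade-permuteCols σ T = trade-ᵀ (trade-permuteRows σ (trade-ᵀ T))

trade-addRow : ∀ {m n} {S : Matrix (suc m) n} → Trade (λ i → S (suc i)) → Trade S
trade-addRow {m} {n} {S} T = record
  { P = withEmptyRow P ; N = withEmptyRow N
  ; P⊆S = ⊆-withEmptyRow P P⊆S ; N⊆S = ⊆-withEmptyRow N N⊆S
  ; rowBalanced = λ { zero → refl ; (suc i) → rowBalanced i }
  ; colBalanced = colBalanced
  ; rowMatching = λ { zero → subst (_≤ 1) (sym (sumFin-zero n)) z≤n
                    ; (suc i) → rowMatching i }
  ; colMatching = colMatching
  ; differ = let open Witness differ in witness (suc row) col P-one N-zero }
  where
  open Trade T
  withEmptyRow : Matrix m n → Matrix (suc m) n
  withEmptyRow X zero    j = false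
  withEmptyRow X (suc i) j = X i j
  ⊆-withEmptyRow : ∀ X → X ⊆ (λ i → S (suc i)) → withEmptyRow X ⊆ S
  ⊆-withEmptyRow X X⊆ (suc i) j x = X⊆ i j x

fourCycle : ∀ {m n} {S : Matrix m n} {r₁ r₂ c₁ c₂} → r₁ ≢ r₂ → c₁ ≢ c₂ →
  S r₁ c₁ ≡ true → S r₁ c₂ ≡ true → S r₂ c₁ ≡ true → S r₂ c₂ ≡ true → Trade S
fourCycle {m} {n} {S} {r₁} {r₂} {c₁} {c₂} r₁≢r₂ c₁≢c₂ s₁₁ s₁₂ s₂₁ s₂₂ = record
  { P = P ; N = N
  ; P⊆S = ∪-⊆ (cell-⊆ s₁₁) (cell-⊆ s₂₂)
  ; N⊆S = ∪-⊆ (cell-⊆ s₁₂) (cell-⊆ s₂₁)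
  ; rowBalanced = λ i → trans (rowSum-P i) (sym (rowSum-N i))
  ; colBalanced = λ j → trans (colSum-P j) (trans (+-comm (χ (δ c₁ j)) (χ (δ c₂ j))) (sym (colSum-N j)))
  ; rowMatching = λ i → subst (_≤ 1) (sym (rowSum-P i))
                          (χ-disjoint≤1 (δ r₁ i) (δ r₂ i) (δ-disjoint r₁≢r₂ i))
  ; colMatching = λ j → subst (_≤ 1) (sym (colSum-P j))
                          (χ-disjoint≤1 (δ c₁ j) (δ c₂ j) (δ-disjoint c₁≢c₂ j))
  ; differ = witness r₁ c₁ P-one N-zero }
  where
  P N : Matrix m n
  P = cell r₁ c₁ ∪ cell r₂ c₂
  N = cell r₁ c₂ ∪ cell r₂ c₁
  rowSum-P : ∀ i → rowSum P i ≡ χ (δ r₁ i) + χ (δ r₂ i)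
  rowSum-P i = trans (rowSum-∪ (cell r₁ c₁) (cell r₂ c₂) i (cell-disjoint r₁≢r₂ c₁ c₂ i))
                     (cong₂ _+_ (rowSum-cell r₁ c₁ i) (rowSum-cell r₂ c₂ i))
  rowSum-N : ∀ i → rowSum N i ≡ χ (δ r₁ i) + χ (δ r₂ i)
  rowSum-N i = trans (rowSum-∪ (cell r₁ c₂) (cell r₂ c₁) i (cell-disjoint r₁≢r₂ c₂ c₁ i))
                     (cong₂ _+_ (rowSum-cell r₁ c₂ i) (rowSum-cell r₂ c₁ i))
  colSum-P : ∀ j → colSum P j ≡ χ (δ c₁ j) + χ (δ c₂ j)
  colSum-P j = trans (colSum-∪ (cell r₁ c₁) (cell r₂ c₂) j (λ i → cell-disjoint r₁≢r₂ c₁ c₂ i j))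
                     (cong₂ _+_ (colSum-cell r₁ c₁ j) (colSum-cell r₂ c₂ j))
  colSum-N : ∀ j → colSum N j ≡ χ (δ c₂ j) + χ (δ c₁ j)
  colSum-N j = trans (colSum-∪ (cell r₁ c₂) (cell r₂ c₁) j (λ i → cell-disjoint r₁≢r₂ c₂ c₁ i j))
                     (cong₂ _+_ (colSum-cell r₁ c₂ j) (colSum-cell r₂ c₁ j))
  P-one : P r₁ c₁ ≡ true
  P-one rewrite δ-refl r₁ | δ-refl c₁ = refl
  N-zero : N r₁ c₁ ≡ false
  N-zero rewrite δ-refl r₁ | δ-refl c₁ | δ-distinct (λ e → c₁≢c₂ (sym e))
               | δ-distinct (λ e → r₁≢r₂ (sym e)) = refl

-- Bits x, y for the first row of a lifted trade: P gets (x at column 0,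
-- y at column c), N gets (y, x), so that the split column sums aP + bP of P
-- and aN + bN of N are balanced again without breaking the matchings.
record FirstRowBits (aP bP aN bN : ℕ) : Set where
  field
    x y        : Bool
    balanced₀  : χ x + aP ≡ χ y + aN
    balancedᶜ  : χ y + bP ≡ χ x + bN
    matchingRow : χ x + χ y ≤ 1
    matching₀  : χ x + aP ≤ 1
    matchingᶜ  : χ y + bP ≤ 1

firstRowBits : ∀ aP bP aN bN → aP + bP ≡ aN + bN → aP + bP ≤ 1 → FirstRowBits aP bP aN bN
firstRowBits 0 bP 0 bN e le =
  record { x = false ; y = false ; balanced₀ = refl ; balancedᶜ = e
         ; matchingRow = z≤n ; matching₀ = z≤n ; matchingᶜ = le }
firstRowBits 1 bP 1 bN e le =
  record { x = false ; y = false ; balanced₀ = refl ; balancedᶜ = suc-injective e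
         ; matchingRow = z≤n ; matching₀ = s≤s z≤n ; matchingᶜ = ≤-trans (n≤1+n bP) le }
firstRowBits 0 bP 1 bN e le =
  record { x = true ; y = false ; balanced₀ = refl ; balancedᶜ = e
         ; matchingRow = s≤s z≤n ; matching₀ = s≤s z≤n ; matchingᶜ = le }
firstRowBits 1 bP 0 bN e le =
  record { x = false ; y = true ; balanced₀ = refl ; balancedᶜ = e
         ; matchingRow = s≤s z≤n ; matching₀ = s≤s z≤n ; matchingᶜ = le }
firstRowBits (suc (suc _)) bP aN bN e (s≤s ())
firstRowBits 0 bP (suc (suc aN)) bN e le with subst (_≤ 1) e le
... | s≤s ()
firstRowBits 1 bP (suc (suc aN)) bN e le with subst (_≤ 1) e le
... | s≤s ()

-- Contracting the path  column 0 — row 0 — column (suc c)  of S, whose row 0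
-- has ones exactly at those two columns: delete row 0 and merge column 0
-- into column (suc c).  The merge is a disjoint union, as no other row has
-- ones in both columns.  A trade of the contracted matrix lifts to S.
module Contraction {m n} (S : Matrix (suc m) (suc n)) (c : Fin n)
  (s₀₀ : S zero zero ≡ true) (s₀c : S zero (suc c) ≡ true)
  (disjoint : ∀ i → S (suc i) zero ∧ S (suc i) (suc c) ≡ false) where

  kept moved contracted : Matrix m n
  kept  i k = S (suc i) (suc k)
  moved i k = S (suc i) zero ∧ δ c k
  contracted = kept ∪ moved

  kept-moved-disjoint : ∀ i k → kept i k ∧ moved i k ≡ false
  kept-moved-disjoint i k with c ≟ k
  ... | yes refl = trans (cong (kept i c ∧_) (∧-identityʳ (S (suc i) zero)))
                         (trans (∧-comm (kept i c) _) (disjoint i))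
  ... | no  _    = trans (cong (kept i k ∧_) (∧-zeroʳ (S (suc i) zero))) (∧-zeroʳ (kept i k))

  rowSum-contracted : ∀ i → rowSum contracted i ≡ rowSum S (suc i)
  rowSum-contracted i = begin
    rowSum contracted i                        ≡⟨ rowSum-∪ kept moved i (kept-moved-disjoint i) ⟩
    rowSum kept i + rowSum moved i             ≡⟨ cong (rowSum kept i +_) (sumFin-sift (λ _ → S (suc i) zero) c) ⟩
    rowSum kept i + χ (S (suc i) zero)         ≡⟨ +-comm (rowSum kept i) _ ⟩
    rowSum S (suc i)                           ∎
    where open ≡-Reasoning

  size-contraction : size S ≡ rowSum S zero + size contracted
  size-contraction = cong (rowSum S zero +_) (sumFin-cong (λ i → sym (rowSum-contracted i)))

  -- Lift X to S: row 0 gets the bits x, y; entries of the merged column go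
  -- back to whichever of column 0, column (suc c) of S they came from.
  lift : Matrix m n → Bool → Bool → Matrix (suc m) (suc n)
  lift X x y zero    zero    = x
  lift X x y zero    (suc k) = y ∧ δ c k
  lift X x y (suc i) zero    = X i c ∧ S (suc i) zero
  lift X x y (suc i) (suc k) = X i k ∧ kept i k

  toZero toC : Matrix m n → ℕ
  toZero X = sumFin (λ i → χ (X i c ∧ S (suc i) zero))
  toC    X = sumFin (λ i → χ (X i c ∧ kept i c))

  lift-⊆ : ∀ X x y → lift X x y ⊆ S
  lift-⊆ X x y zero    zero    _ = s₀₀
  lift-⊆ X x y zero    (suc k) e =
    subst (λ k → S zero (suc k) ≡ true) (δ-sound (proj₂ (∧-true {y} e))) s₀c
  lift-⊆ X x y (suc i) zero    e = proj₂ (∧-true {X i c} e)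
  lift-⊆ X x y (suc i) (suc k) e = proj₂ (∧-true {X i k} e)

  rowSum-lift₀ : ∀ X x y → rowSum (lift X x y) zero ≡ χ x + χ y
  rowSum-lift₀ X x y = cong (χ x +_) (sumFin-sift (λ _ → y) c)

  colSum-liftᶜ : ∀ X x y → colSum (lift X x y) (suc c) ≡ χ y + toC X
  colSum-liftᶜ X x y =
    cong (λ z → χ z + toC X) (trans (cong (y ∧_) (δ-refl c)) (∧-identityʳ y))

  module _ (X : Matrix m n) (X⊆ : X ⊆ contracted) where

    split : ∀ i k → χ (X i k) ≡ χ (X i k ∧ kept i k) + χ ((X i k ∧ S (suc i) zero) ∧ δ c k)
    split i k = trans (χ-split (X i k) (kept i k) (moved i k) (X⊆ i k) (kept-moved-disjoint i k))
                      (cong (λ z → χ (X i k ∧ kept i k) + χ z) (sym (∧-assoc (X i k) _ _)))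

    rowSum-lift : ∀ x y i → rowSum (lift X x y) (suc i) ≡ rowSum X i
    rowSum-lift x y i = sym (begin
      rowSum X i
        ≡⟨ sumFin-cong (split i) ⟩
      sumFin (λ k → χ (X i k ∧ kept i k) + χ ((X i k ∧ S (suc i) zero) ∧ δ c k))
        ≡⟨ sumFin-+ (λ k → χ (X i k ∧ kept i k)) (λ k → χ ((X i k ∧ S (suc i) zero) ∧ δ c k)) ⟩
      rowSum (λ i k → X i k ∧ kept i k) i + sumFin (λ k → χ ((X i k ∧ S (suc i) zero) ∧ δ c k))
        ≡⟨ cong (rowSum (λ i k → X i k ∧ kept i k) i +_) (sumFin-sift (λ k → X i k ∧ S (suc i) zero) c) ⟩
      rowSum (λ i k → X i k ∧ kept i k) i + χ (X i c ∧ S (suc i) zero)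
        ≡⟨ +-comm (rowSum (λ i k → X i k ∧ kept i k) i) _ ⟩
      rowSum (lift X x y) (suc i) ∎)
      where open ≡-Reasoning

    kept-part : ∀ i k → c ≢ k → χ (X i k ∧ kept i k) ≡ χ (X i k)
    kept-part i k c≢k = sym (begin
      χ (X i k)                                                   ≡⟨ split i k ⟩
      χ (X i k ∧ kept i k) + χ ((X i k ∧ S (suc i) zero) ∧ δ c k) ≡⟨ cong (λ z → χ (X i k ∧ kept i k) + χ ((X i k ∧ S (suc i) zero) ∧ z)) (δ-distinct c≢k) ⟩
      χ (X i k ∧ kept i k) + χ ((X i k ∧ S (suc i) zero) ∧ false) ≡⟨ cong (λ z → χ (X i k ∧ kept i k) + χ z) (∧-zeroʳ _) ⟩
      χ (X i k ∧ kept i k) + 0                                    ≡⟨ +-identityʳ _ ⟩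
      χ (X i k ∧ kept i k)                                        ∎)
      where open ≡-Reasoning

    colSum-lift-other : ∀ x y k → c ≢ k → colSum (lift X x y) (suc k) ≡ colSum X k
    colSum-lift-other x y k c≢k rewrite δ-distinct c≢k | ∧-zeroʳ y =
      sumFin-cong (λ i → kept-part i k c≢k)

    toZero+toC : toZero X + toC X ≡ colSum X c
    toZero+toC = begin
      toZero X + toC X                                   ≡⟨ +-comm (toZero X) (toC X) ⟩
      toC X + toZero X                                   ≡⟨ sym (sumFin-+ (λ i → χ (X i c ∧ kept i c)) (λ i → χ (X i c ∧ S (suc i) zero))) ⟩
      sumFin (λ i → χ (X i c ∧ kept i c) + χ (X i c ∧ S (suc i) zero)) ≡⟨ sumFin-cong (λ i → sym (at-c i)) ⟩
      colSum X c                                         ∎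
      where
      open ≡-Reasoning
      at-c : ∀ i → χ (X i c) ≡ χ (X i c ∧ kept i c) + χ (X i c ∧ S (suc i) zero)
      at-c i = trans (split i c) (cong (λ z → χ (X i c ∧ kept i c) + χ z)
                                       (trans (cong ((X i c ∧ S (suc i) zero) ∧_) (δ-refl c))
                                              (∧-identityʳ _)))

  lift-trade : Trade contracted → Trade S
  lift-trade T = record
    { P = P↑ ; N = N↑
    ; P⊆S = lift-⊆ P x y ; N⊆S = lift-⊆ N y x
    ; rowBalanced = rowBalanced↑ ; colBalanced = colBalanced↑
    ; rowMatching = rowMatching↑ ; colMatching = colMatching↑
    ; differ = differ↑ }
    where
    open Trade T
    bits : FirstRowBits (toZero P) (toC P) (toZero N) (toC N)
    bits = firstRowBits _ _ _ _
      (trans (toZero+toC P P⊆S) (trans (colBalanced c) (sym (toZero+toC N N⊆S))))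
      (subst (_≤ 1) (sym (toZero+toC P P⊆S)) (colMatching c))
    open FirstRowBits bits
    P↑ N↑ : Matrix (suc m) (suc n)
    P↑ = lift P x y
    N↑ = lift N y x

    rowBalanced↑ : ∀ i → rowSum P↑ i ≡ rowSum N↑ i
    rowBalanced↑ zero    = trans (rowSum-lift₀ P x y)
                             (trans (+-comm (χ x) (χ y)) (sym (rowSum-lift₀ N y x)))
    rowBalanced↑ (suc i) = trans (rowSum-lift P P⊆S x y i)
                             (trans (rowBalanced i) (sym (rowSum-lift N N⊆S y x i)))

    colBalanced↑ : ∀ k → colSum P↑ k ≡ colSum N↑ k
    colBalanced↑ zero = balanced₀
    colBalanced↑ (suc k) = atColumn (c ≟ k)
      where
      atColumn : Dec (c ≡ k) → colSum P↑ (suc k) ≡ colSum N↑ (suc k)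
      atColumn (yes refl) = trans (colSum-liftᶜ P x y) (trans balancedᶜ (sym (colSum-liftᶜ N y x)))
      atColumn (no  c≢k)  = trans (colSum-lift-other P P⊆S x y k c≢k)
                              (trans (colBalanced k) (sym (colSum-lift-other N N⊆S y x k c≢k)))

    rowMatching↑ : ∀ i → rowSum P↑ i ≤ 1
    rowMatching↑ zero    = subst (_≤ 1) (sym (rowSum-lift₀ P x y)) matchingRow
    rowMatching↑ (suc i) = subst (_≤ 1) (sym (rowSum-lift P P⊆S x y i)) (rowMatching i)

    colMatching↑ : ∀ k → colSum P↑ k ≤ 1
    colMatching↑ zero = matching₀
    colMatching↑ (suc k) = atColumn (c ≟ k)
      where
      atColumn : Dec (c ≡ k) → colSum P↑ (suc k) ≤ 1
      atColumn (yes refl) = subst (_≤ 1) (sym (colSum-liftᶜ P x y)) matchingᶜ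
      atColumn (no  c≢k)  = subst (_≤ 1) (sym (colSum-lift-other P P⊆S x y k c≢k)) (colMatching k)

    -- The differing cell stays in place unless it came from column 0.
    differ↑ : Witness P↑ N↑
    differ↑ with kept row col in kept≡
      where open Witness differ
    ... | true  = witness (suc row) (suc col) (cong₂ _∧_ P-one kept≡) (cong (_∧ kept row col) N-zero)
      where open Witness differ
    ... | false = witness (suc row) zero
        (cong₂ _∧_ (subst (λ k → P row k ≡ true) (sym c≡col) P-one) (proj₁ from-moved))
        (cong (_∧ S (suc row) zero) (subst (λ k → N row k ≡ false) (sym c≡col) N-zero))
      where
      open Witness differ
      from-moved : S (suc row) zero ≡ true × δ c col ≡ true
      from-moved = ∧-true (trans (sym (cong (_∨ moved row col) kept≡)) (P⊆S row col P-one))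
      c≡col : c ≡ col
      c≡col = δ-sound (proj₂ from-moved)

fin⇒pos : ∀ {n} → Fin n → 1 ≤ n
fin⇒pos {suc n} _ = s≤s z≤n

nonempty⇒rows : ∀ {m n} (S : Matrix m n) → 1 ≤ size S → 1 ≤ m
nonempty⇒rows {suc m} S _ = s≤s z≤n

nonempty⇒cols : ∀ {m n} (S : Matrix m n) → 1 ≤ size S → 1 ≤ n
nonempty⇒cols {m} {zero} S pos with subst (1 ≤_) (sumFin-zero m) pos
... | ()
nonempty⇒cols {m} {suc n} S _ = s≤s z≤n

dense⇒surplus : ∀ m n s → 1 ≤ m + n → m * 3 ≤ s → n * 3 ≤ s → m + n < s
dense⇒surplus m n s lines>0 rows cols = *-cancelˡ-< 2 (m + n) s (begin-strict
  2 * (m + n)              <⟨ m<n+m (2 * (m + n)) lines>0 ⟩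
  (m + n) + 2 * (m + n)    ≡⟨ solve (m ∷ n ∷ []) ⟩
  m * 3 + n * 3            ≤⟨ +-mono-≤ rows cols ⟩
  s + s                    ≡⟨ solve (s ∷ []) ⟩
  2 * s                    ∎)
  where open ≤-Reasoning

-- The induction measure for trade-exists: rows + columns + ones.
weight : ∀ {m n} → Matrix m n → ℕ
weight {m} {n} S = m + n + size S

TradesBelow : ℕ → Set
TradesBelow w = ∀ {m n} (S : Matrix m n) → weight S < w → m + n ≤ size S → 1 ≤ size S → Trade S

-- The steps
-- only assume weight S ≤ w, so that they may be chained through row and
-- column permutations and transposition, which keep the weight.
module Reduction (w : ℕ) (smaller : TradesBelow w) where

  dropRow : ∀ {m n} (S : Matrix (suc m) n) → weight S ≤ w →
    suc m + n ≤ size S → 1 ≤ size S → rowSum S zero ≤ 1 → Trade S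
  dropRow {m} {n} S bound dense nonempty sparse =
    trade-addRow (smaller S′ lighter dense′ (≤-trans lines>0 dense′))
    where
    S′ : Matrix m n
    S′ i = S (suc i)
    dense′ : m + n ≤ size S′
    dense′ = ≤-pred (≤-trans dense (+-monoˡ-≤ (size S′) sparse))
    lines>0 : 1 ≤ m + n
    lines>0 = ≤-trans (nonempty⇒cols S nonempty) (m≤n+m n m)
    lighter : weight S′ < w
    lighter = <-≤-trans (s≤s (+-monoʳ-≤ (m + n) (m≤n+m (size S′) (rowSum S zero)))) bound

  -- A first row with exactly two ones, at columns 0 and (suc c): either
  -- they lie on a 4-cycle, or the path through them is contracted.
  contractRow : ∀ {m n} (S : Matrix (suc m) (suc n)) → weight S ≤ w →
    suc m + suc n ≤ size S → rowSum S zero ≡ 2 →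
    (c : Fin n) → S zero zero ≡ true → S zero (suc c) ≡ true → Trade S
  contractRow {m} {n} S bound dense two c s₀₀ s₀c
    with any? (λ i → (S (suc i) zero ∧ S (suc i) (suc c)) Bool.≟ true)
  ... | yes (i , both) = fourCycle {r₁ = zero} {suc i} {zero} {suc c} (λ ()) (λ ())
                           s₀₀ s₀c (proj₁ (∧-true both)) (proj₂ (∧-true both))
  ... | no none = lift-trade (smaller contracted lighter dense′ (≤-trans lines>0 dense′))
    where
    open Contraction S c s₀₀ s₀c (λ i → ¬-not (λ both → none (i , both)))
    size≡ : size S ≡ 2 + size contracted
    size≡ = trans size-contraction (cong (_+ size contracted) two)
    dense′ : m + n ≤ size contracted
    dense′ = ≤-pred (≤-pred (subst₂ _≤_ (cong suc (+-suc m n)) size≡ dense))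
    lines>0 : 1 ≤ m + n
    lines>0 = ≤-trans (fin⇒pos c) (m≤n+m n m)
    lighter : weight contracted < w
    lighter = begin-strict
      m + n + size contracted      <⟨ +-monoʳ-< (m + n) (subst (size contracted <_) (sym size≡) (s≤s (n≤1+n _))) ⟩
      m + n + size S               ≤⟨ +-monoˡ-≤ (size S) (+-mono-≤ (n≤1+n m) (n≤1+n n)) ⟩
      weight S                     ≤⟨ bound ⟩
      w                            ∎
      where open ≤-Reasoning

  twoOnesRow : ∀ {m n} (S : Matrix (suc m) n) → weight S ≤ w →
    suc m + n ≤ size S → rowSum S zero ≡ 2 →
    (j₁ j₂ : Fin n) → j₁ ≢ j₂ → S zero j₁ ≡ true → S zero j₂ ≡ true → Trade S
  twoOnesRow {m} {suc n} S bound dense two j₁ j₂ j₁≢j₂ s₁ s₂ =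
    trade-permuteCols σ (withOneAt (σ ⟨$⟩ˡ j₁) refl)
    where
    σ : Permutation (suc n) (suc n)
    σ = Perm.transpose zero j₂
    S₂ : Matrix (suc m) (suc n)
    S₂ = permuteCols σ S
    size≡ : size S₂ ≡ size S
    size≡ = size-permuteCols σ S
    withOneAt : ∀ k → σ ⟨$⟩ˡ j₁ ≡ k → Trade S₂
    withOneAt zero    at₀ = ⊥-elim (j₁≢j₂ (trans (sym (Perm.inverseʳ σ)) (cong (σ ⟨$⟩ʳ_) at₀)))
    withOneAt (suc c) atc =
      contractRow S₂ (subst (_≤ w) (cong (suc m + suc n +_) (sym size≡)) bound)
        (subst (suc m + suc n ≤_) (sym size≡) dense)
        (trans (rowSum-permuteCols σ S zero) two) c s₂
        (subst (λ k → S zero (σ ⟨$⟩ʳ k) ≡ true) atc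
          (subst (λ k → S zero k ≡ true) (sym (Perm.inverseʳ σ)) s₁))

  sparseRow₀ : ∀ {m n} (S : Matrix (suc m) n) → weight S ≤ w →
    suc m + n ≤ size S → 1 ≤ size S → rowSum S zero ≤ 2 → Trade S
  sparseRow₀ S bound dense nonempty sparse with rowSum S zero ≤? 1
  ... | yes ≤1 = dropRow S bound dense nonempty ≤1
  ... | no  ≰1 with twoOf (S zero) (≰⇒> ≰1)
  ...   | j₁ , j₂ , j₁≢j₂ , s₁ , s₂ =
          twoOnesRow S bound dense (≤-antisym sparse (≰⇒> ≰1)) j₁ j₂ j₁≢j₂ s₁ s₂

  sparseRow : ∀ {m n} (S : Matrix m n) → weight S ≤ w →
    m + n ≤ size S → 1 ≤ size S → (r : Fin m) → rowSum S r ≤ 2 → Trade S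
  sparseRow {suc m} {n} S bound dense nonempty r sparse =
    trade-permuteRows π (sparseRow₀ S₁ (subst (_≤ w) (cong (suc m + n +_) (sym size≡)) bound)
      (subst (suc m + n ≤_) (sym size≡) dense) (subst (1 ≤_) (sym size≡) nonempty) sparse)
    where
    π : Permutation (suc m) (suc m)
    π = Perm.transpose zero r
    S₁ : Matrix (suc m) n
    S₁ = permuteRows π S
    size≡ : size S₁ ≡ size S
    size≡ = size-permuteRows π S

  -- Every line has at least three ones: then there is a one to spare.
  denseStep : ∀ {m n} (S : Matrix m n) → weight S ≤ w → 1 ≤ size S →
    (∀ i → 3 ≤ rowSum S i) → (∀ j → 3 ≤ colSum S j) → Trade S
  denseStep {m} {n} S bound nonempty rows≥3 cols≥3
    with sumFin-pos (rowSum S) nonempty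
  ... | r , row>0 with oneOf (S r) row>0
  ...   | c , Src = trade-⊆ (λ i j S′ij → proj₁ (∧-true S′ij))
                      (smaller S′ lighter dense′ (≤-trans lines>0 dense′))
    where
    S′ : Matrix m n
    S′ = removeCell r c S
    size≡ : size S ≡ size S′ + 1
    size≡ = size-removeCell S Src
    lines>0 : 1 ≤ m + n
    lines>0 = ≤-trans (nonempty⇒rows S nonempty) (m≤m+n m n)
    surplus : m + n < size S
    surplus = dense⇒surplus m n (size S) lines>0
      (subst (_≤ size S) (sumFin-const {m} 3) (sumFin-mono rows≥3))
      (subst₂ _≤_ (sumFin-const {n} 3) (size-ᵀ S) (sumFin-mono cols≥3))
    dense′ : m + n ≤ size S′
    dense′ = ≤-pred (subst (suc (m + n) ≤_) (trans size≡ (+-comm (size S′) 1)) surplus)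
    lighter : weight S′ < w
    lighter = <-≤-trans (+-monoʳ-< (m + n) (subst (size S′ <_) (sym size≡) (m<m+n (size S′) (s≤s z≤n)))) bound

  step : ∀ {m n} (S : Matrix m n) → weight S ≤ w → m + n ≤ size S → 1 ≤ size S → Trade S
  step {m} {n} S bound dense nonempty with any? (λ i → rowSum S i ≤? 2)
  ... | yes (r , sparse) = sparseRow S bound dense nonempty r sparse
  ... | no  rows≥3 with any? (λ j → colSum S j ≤? 2)
  ...   | yes (c , sparse) = trade-ᵀ (sparseRow (S ᵀ) boundᵀ denseᵀ nonemptyᵀ c sparse)
    where
    boundᵀ : weight (S ᵀ) ≤ w
    boundᵀ = subst (_≤ w) (cong₂ _+_ (+-comm m n) (sym (size-ᵀ S))) bound
    denseᵀ : n + m ≤ size (S ᵀ)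
    denseᵀ = subst₂ _≤_ (+-comm m n) (sym (size-ᵀ S)) dense
    nonemptyᵀ : 1 ≤ size (S ᵀ)
    nonemptyᵀ = subst (1 ≤_) (sym (size-ᵀ S)) nonempty
  ...   | no  cols≥3 = denseStep S bound nonempty
                         (λ i → ≰⇒> (λ ≤2 → rows≥3 (i , ≤2)))
                         (λ j → ≰⇒> (λ ≤2 → cols≥3 (j , ≤2)))

-- A nonempty 0/1 matrix with at least as many ones as lines (rows plus
-- columns) contains a trade: a bipartite graph with at least as many edges
-- as vertices has an (even) cycle.
trade-exists : ∀ {m n} (S : Matrix m n) → m + n ≤ size S → 1 ≤ size S → Trade S
trade-exists S = <-rec TradesBelow below (suc (weight S)) S ≤-refl
  where
  below : ∀ w → (∀ {v} → v < w → TradesBelow v) → TradesBelow w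
  below w smaller S lighter = Reduction.step (weight S) (smaller lighter) S ≤-refl

-- The multiplicity 1 + χ p − χ q of a symbol in a traded cell.
shifted : Bool → Bool → ℕ
shifted true  true  = 1
shifted true  false = 2
shifted false true  = 0
shifted false false = 1

shifted-χ : ∀ p q → shifted p q + χ q ≡ 1 + χ p
shifted-χ true  true  = refl
shifted-χ true  false = refl
shifted-χ false true  = refl
shifted-χ false false = refl

sumFin-shifted : ∀ {n} (p q : Fin n → Bool) →
  sumFin (λ j → χ (p j)) ≡ sumFin (λ j → χ (q j)) →
  sumFin (λ j → shifted (p j) (q j)) ≡ n
sumFin-shifted {n} p q balanced = +-cancelʳ-≡ Σq _ n (begin
  sumFin (λ j → shifted (p j) (q j)) + Σq  ≡⟨ sym (sumFin-+ (λ j → shifted (p j) (q j)) (λ j → χ (q j))) ⟩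
  sumFin (λ j → shifted (p j) (q j) + χ (q j))  ≡⟨ sumFin-cong (λ j → shifted-χ (p j) (q j)) ⟩
  sumFin (λ j → 1 + χ (p j))                 ≡⟨ sumFin-+ (λ _ → 1) (λ j → χ (p j)) ⟩
  sumFin {n} (λ _ → 1) + Σp                 ≡⟨ cong₂ _+_ (trans (sumFin-const {n} 1) (*-identityʳ n)) balanced ⟩
  n + Σq                                    ∎)
  where
  open ≡-Reasoning
  Σp Σq : ℕ
  Σp = sumFin (λ j → χ (p j))
  Σq = sumFin (λ j → χ (q j))

onAB : ∀ {t} → Fin t → Fin t → Fin t → Bool → Bool → Bool
onAB a b k p q = if δ a k then p else if δ b k then q else false

onAB-balanced : ∀ {t n} (a b k : Fin t) (p q : Fin n → Bool) →
  sumFin (λ j → χ (p j)) ≡ sumFin (λ j → χ (q j)) →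
  sumFin (λ j → χ (onAB a b k (p j) (q j))) ≡ sumFin (λ j → χ (onAB a b k (q j) (p j)))
onAB-balanced a b k p q balanced with δ a k
... | true  = balanced
... | false with δ b k
...   | true  = sym balanced
...   | false = refl

onAB-count : ∀ {t} {a b : Fin t} → a ≢ b → ∀ p q →
  sumFin (λ k → χ (onAB a b k p q)) ≡ χ p + χ q
onAB-count {a = a} {b} a≢b p q = begin
  sumFin (λ k → χ (onAB a b k p q))
    ≡⟨ sumFin-cong pointwise ⟩
  sumFin (λ k → χ (p ∧ δ a k) + χ (q ∧ δ b k))
    ≡⟨ sumFin-+ (λ k → χ (p ∧ δ a k)) (λ k → χ (q ∧ δ b k)) ⟩
  sumFin (λ k → χ (p ∧ δ a k)) + sumFin (λ k → χ (q ∧ δ b k))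
    ≡⟨ cong₂ _+_ (sumFin-sift (λ _ → p) a) (sumFin-sift (λ _ → q) b) ⟩
  χ p + χ q ∎
  where
  open ≡-Reasoning
  pointwise : ∀ k → χ (onAB a b k p q) ≡ χ (p ∧ δ a k) + χ (q ∧ δ b k)
  pointwise k with δ a k | δ b k | δ-disjoint a≢b k
  ... | true  | true  | ()
  ... | true  | false | _ rewrite ∧-identityʳ p | ∧-zeroʳ q = sym (+-identityʳ (χ p))
  ... | false | true  | _ rewrite ∧-zeroʳ p | ∧-identityʳ q = refl
  ... | false | false | _ rewrite ∧-zeroʳ p | ∧-zeroʳ q = refl

onAB-avoids : ∀ {t} {a b : Fin t} (cell : Fin t → Bool) k p q → cell k ≡ true →
  (p ≡ true → cell a ≡ false × cell b ≡ false) →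
  (q ≡ true → cell a ≡ false × cell b ≡ false) → onAB a b k p q ≡ false
onAB-avoids {a = a} {b} cell k p q k∈cell p-avoids q-avoids with a ≟ k | b ≟ k
... | yes refl | _        = excluded k∈cell (λ p≡true → proj₁ (p-avoids p≡true))
... | no  _    | yes refl = excluded k∈cell (λ q≡true → proj₂ (q-avoids q≡true))
... | no  _    | no  _    = refl

-- A trade (P, N) in S gives a balanced rectangle other than F: in each
-- cell, one copy of symbol b is traded for a copy of a where P has a one,
-- and the other way round where N has one.
module SecondCompletion {m n t} (a b : Fin t) (a≢b : a ≢ b) {S : Matrix m n} (T : Trade S) where
  open Trade T

  L : Array m n t
  L i j k = shifted (onAB a b k (P i j) (N i j)) (onAB a b k (N i j) (P i j))

  L-balanced : IsBalanced L
  L-balanced = cells , rows , cols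
    where
    cells : ∀ i j → ∣ L i j ∣ₘ ≡ t
    cells i j = sumFin-shifted _ _ (trans (onAB-count a≢b (P i j) (N i j))
                  (trans (+-comm (χ (P i j)) (χ (N i j))) (sym (onAB-count a≢b (N i j) (P i j)))))
    rows : ∀ i k → sumFin (λ j → L i j k) ≡ n
    rows i k = sumFin-shifted _ _ (onAB-balanced a b k (P i) (N i) (rowBalanced i))
    cols : ∀ j k → sumFin (λ i → L i j k) ≡ m
    cols j k = sumFin-shifted _ _ (onAB-balanced a b k (λ i → P i j) (λ i → N i j) (colBalanced j))

  L-differs : let open Witness differ in L row col a ≡ 2
  L-differs rewrite δ-refl a | Witness.P-one differ | Witness.N-zero differ = refl

  L-contains : (D : SubsetArray m n t) →
    (∀ i j → S i j ≡ true → D i j a ≡ false × D i j b ≡ false) → asArray D ⊑ L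
  L-contains D S-avoids i j k with D i j k in k∈D
  ... | false = z≤n
  ... | true = subst₂ (λ x y → 1 ≤ shifted x y)
                   (sym (onAB-avoids (D i j) k (P i j) (N i j) k∈D avoidsP avoidsN))
                   (sym (onAB-avoids (D i j) k (N i j) (P i j) k∈D avoidsN avoidsP)) ≤-refl
    where
    avoidsP : P i j ≡ true → D i j a ≡ false × D i j b ≡ false
    avoidsP p = S-avoids i j (P⊆S i j p)
    avoidsN : N i j ≡ true → D i j a ≡ false × D i j b ≡ false
    avoidsN q = S-avoids i j (N⊆S i j q)

avoiding : ∀ {m n t} → SubsetArray m n t → Fin t → Fin t → Matrix m n
avoiding D a b i j = not (D i j a) ∧ not (D i j b)

avoiding-sound : ∀ {m n t} (D : SubsetArray m n t) a b i j →
  avoiding D a b i j ≡ true → D i j a ≡ false × D i j b ≡ false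
avoiding-sound D a b i j e with D i j a | D i j b
... | false | false = refl , refl

sizeS≡size : ∀ {m n t} (D : SubsetArray m n t) a b → sizeS D a b ≡ size (avoiding D a b)
sizeS≡size D a b = sumFin-cong (λ i → sumFin-cong (λ j → neither (D i j a) (D i j b)))
  where
  neither : ∀ x y → χneither x y ≡ χ (not x ∧ not y)
  neither false false = refl
  neither false true  = refl
  neither true  _     = refl

-- If S = avoiding D a b had more than m + n − 1 ones, a trade in S would
-- give a completion L of D with two copies of a in some cell, so L ≠ F.
lemma2p1 : ∀ (m n t : ℕ) → 1 ≤ m → 1 ≤ n → 2 ≤ t →
    (D : SubsetArray m n t) → IsPartial (asArray D) →
    IsDefiningSetForF (asArray D) →
    (a b : Fin t) → a ≢ b →
    sizeS D a b ≤ m + n ∸ 1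
lemma2p1 (suc m) n t _ _ _ D _ (_ , unique) a b a≢b with sizeS D a b ≤? m + n
... | yes bounded  = bounded
... | no  exceeded = ⊥-elim (2≢1 (trans (sym L-differs) (unique L (L-balanced , L⊒D) row col a)))
  where
  S : Matrix (suc m) n
  S = avoiding D a b
  dense : suc m + n ≤ size S
  dense = subst (suc m + n ≤_) (sizeS≡size D a b) (≰⇒> exceeded)
  T : Trade S
  T = trade-exists S dense (≤-trans (s≤s z≤n) dense)
  open SecondCompletion a b a≢b T
  open Witness (Trade.differ T)
  L⊒D : asArray D ⊑ L
  L⊒D = L-contains D (avoiding-sound D a b)
  2≢1 : 2 ≢ 1
  2≢1 ()
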